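{- Let $G$ be a graph, $k$ a positive integer, and $(T,\beta)$ a nice tree decomposition of $G$ of width at most $2k$. For every node $t\in V(T)$ and every pair $(D,\tau)$, the number of sets $S$ such that $(D,\tau,S)$ is a promising partial solution for $t$ is at most $2^{O(k)}$ (with the constant in the $O(\cdot)$ independent of $G$, $T$, $t$, $D$, $\tau$ and $k$).
   Context: A tree decomposition of $G$ is a pair $(T,\beta)$ with $T$ a tree and $\beta\colon V(T)\to 2^{V(G)}$ such that every vertex lies in some bag, every edge has both endpoints in some bag, and for every vertex $v$ the nodes whose bags contain $v$ induce a connected subtree; its width is $\max_t|\beta(t)|-1$. It is nice if $T$ is rooted and binary and every node $t$ is either an introduce node (one child $t'$ with $\beta(t)=\beta(t')\cup\{v\}$, $v\notin\beta(t')$, or a leaf with $\beta(t)=\{v\}$), a forget node (one child $t'$ with $\beta(t')=\beta(t)\cup\{v\}$, $v\notin\beta(t)$), or a join node (two children with bags equal to $\beta(t)$). For a node $t$, $G_t$ is the subgraph of $G$ induced by all vertices introduced at $t$ or at a descendant of $t$. The height of a rooted tree is the number of vertices on a longest root-to-leaf path. For a rooted tree $D$ and $X\subseteq V(D)$, $\mathrm{Clos}_D(X)$ is the subgraph of $D$ induced by $X$ and all ancestors of vertices of $X$. A partial solution for a graph $H$ is a pair $(D',\tau')$ where $D'$ is a rooted tree of height at most $k$ and $\tau'\colon V(H)\to V(D')$ is injective such that: for every $uv\in E(H)$, $\tau'(u)$ and $\tau'(v)$ are in an ancestor–descendant relationship in $D'$; for every $uv\in E(D')$ with $u,v\in\tau'(V(H))$,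 $\tau'^{ -1}(u)\tau'^{ -1}(v)\in E(H)$; and every leaf of $D'$ lies in $\tau'(V(H))$. A partial solution for a node $t$ is a triple $(D,\tau,S)$ where $D$ is a rooted tree, $\tau\colon\beta(t)\to V(D)$ is injective and $S\subseteq V(D)$, such that there exists a partial solution $(D',\tau')$ for $G_t$ with $D=\mathrm{Clos}_{D'}(\tau'(\beta(t)))$, $\tau = \tau'|_{\beta(t)}$, $\tau'(V(G_t)\setminus\beta(t))\cap V(D)=S$ and $\tau'(V(G_t)\setminus\beta(t))\setminus V(D) = V(D')\setminus V(D)$. Such a partial solution is promising if there is no edge of $D$ between a vertex of $S$ and a vertex of $V(D)\setminus(S\cup\tau(\beta(t)))$. -}

module Defs where

open import Data.Nat using (ℕ; zero; suc; _≤_; _<_; _*_; _^_)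
open import Data.Fin using (Fin)
open import Data.Fin.Subset using (Subset; _∈_; _∉_; _∪_; ⁅_⁆; ∣_∣)
open import Data.Maybe using (Maybe; just; nothing)
open import Data.Product using (Σ; ∃; ∃-syntax; _×_; _,_)
open import Data.Sum using (_⊎_)
open import Data.List using (List; length)
open import Data.List.Relation.Unary.All using (All)
open import Data.List.Relation.Unary.Unique.Propositional using (Unique)
open import Relation.Nullary using (¬_)
open import Relation.Binary.PropositionalEquality using (_≡_; _≢_)
open import Function using (_⇔_)

record Graph : Set₁ where
  field
    n     : ℕ
    E     : Fin n → Fin n → Set
    E-sym : ∀ {u v} → E u v → E v u
    E-irr : ∀ {v} → ¬ E v v

-- Rooted digraphs given by a parent function on Fin size
-- (par v ≡ nothing means v is a root, par v ≡ just p means p is v's parent).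

record RGraph : Set where
  field
    size : ℕ
    par  : Fin size → Maybe (Fin size)

module _ (R : RGraph) where
  open RGraph R

  Edge : Fin size → Fin size → Set
  Edge x y = par x ≡ just y ⊎ par y ≡ just x

  data Anc : Fin size → Fin size → Set where
    anc-refl : ∀ {v} → Anc v v
    anc-step : ∀ {u v p} → par v ≡ just p → Anc u p → Anc u v

  Comparable : Fin size → Fin size → Set
  Comparable x y = Anc x y ⊎ Anc y x

  Leaf : Fin size → Set
  Leaf v = ∀ c → par c ≢ just v

  -- R is a rooted tree: the parent relation is acyclic and there is exactly one root
  IsRootedTree : Set
  IsRootedTree =
    (Σ (Fin size → ℕ) λ rank → (∀ u v → par v ≡ just u → rank u < rank v))
    × (∃[ r ] (par r ≡ nothing × (∀ v → par v ≡ nothing → v ≡ r)))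

  -- Depth v d : the root–v path has exactly d vertices
  data Depth : Fin size → ℕ → Set where
    depth-root : ∀ {v} → par v ≡ nothing → Depth v 1
    depth-step : ∀ {v p d} → par v ≡ just p → Depth p d → Depth v (suc d)

  HeightAtMost : ℕ → Set
  HeightAtMost k = ∀ v d → Depth v d → d ≤ k

  data WalkIn (X : Fin size → Set) : Fin size → Fin size → Set where
    walk-here : ∀ {a} → WalkIn X a a
    walk-step : ∀ {a c b} → Edge a c → X c → WalkIn X c b → WalkIn X a b

  ConnectedIn : (Fin size → Set) → Set
  ConnectedIn X = ∀ a b → X a → X b → WalkIn X a b

module _ {n : ℕ} (T : RGraph) (β : Fin (RGraph.size T) → Subset n) where
  open RGraph T

  Child : Fin size → Fin size → Set
  Child c t = par c ≡ just t

  IsLeafNode : Fin size → Set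
  IsLeafNode t = (∀ c → ¬ Child c t) × (∃[ v ] β t ≡ ⁅ v ⁆)

  IsIntroduceNode : Fin size → Set
  IsIntroduceNode t = ∃[ t' ] (Child t' t × (∀ c → Child c t → c ≡ t')
                      × ∃[ v ] (v ∉ β t' × β t ≡ β t' ∪ ⁅ v ⁆))

  IsForgetNode : Fin size → Set
  IsForgetNode t = ∃[ t' ] (Child t' t × (∀ c → Child c t → c ≡ t')
                   × ∃[ v ] (v ∉ β t × β t' ≡ β t ∪ ⁅ v ⁆))

  IsJoinNode : Fin size → Set
  IsJoinNode t = ∃[ t₁ ] ∃[ t₂ ] (t₁ ≢ t₂ × Child t₁ t × Child t₂ t
                 × (∀ c → Child c t → c ≡ t₁ ⊎ c ≡ t₂)
                 × β t₁ ≡ β t × β t₂ ≡ β t)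

  IntroducedAt : Fin size → Fin n → Set
  IntroducedAt s v = ((∀ c → ¬ Child c s) × β s ≡ ⁅ v ⁆)
                   ⊎ (∃[ s' ] (Child s' s × v ∉ β s' × β s ≡ β s' ∪ ⁅ v ⁆))

  InGt : Fin size → Fin n → Set
  InGt t v = ∃[ s ] (Anc T t s × IntroducedAt s v)

record NiceTD (G : Graph) : Set where
  open Graph G
  field
    T      : RGraph
    β      : Fin (RGraph.size T) → Subset n
    T-tree : IsRootedTree T
    cover-vertices : ∀ v → ∃[ t ] v ∈ β t
    cover-edges    : ∀ u v → E u v → ∃[ t ] (u ∈ β t × v ∈ β t)
    connected      : ∀ v → ConnectedIn T (λ t → v ∈ β t)
    nice : ∀ t → IsLeafNode T β t ⊎ IsIntroduceNode T β t
                 ⊎ IsForgetNode T β t ⊎ IsJoinNode T β t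

-- width ≤ w, i.e. max_t |β(t)| - 1 ≤ w
WidthAtMost : ∀ {G} → NiceTD G → ℕ → Set
WidthAtMost TD w = ∀ t → ∣ NiceTD.β TD t ∣ ≤ suc w

module _ (G : Graph) (k : ℕ) where
  open Graph G

  -- (D', τ') is a partial solution for the induced subgraph H = G[V],
  -- V given as a predicate on Fin n; τ' is a total function of which
  -- only its restriction to V matters.
  IsPartialSolutionFor : (V : Fin n → Set) (D' : RGraph) → (Fin n → Fin (RGraph.size D')) → Set
  IsPartialSolutionFor V D' τ' =
      IsRootedTree D'
    × HeightAtMost D' k
    × (∀ u v → V u → V v → τ' u ≡ τ' v → u ≡ v)
    × (∀ u v → V u → V v → E u v → Comparable D' (τ' u) (τ' v))
    × (∀ u v → V u → V v → Edge D' (τ' u) (τ' v) → E u v)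
    × (∀ x → Leaf D' x → ∃[ u ] (V u × τ' u ≡ x))

  module _ (TD : NiceTD G) where
    open NiceTD TD

    -- (D, τ, S) is a partial solution for node t.  τ is a total function
    -- Fin n → V(D); only its restriction to β(t) matters.  D is identified
    -- with Clos_{D'}(τ'(β(t))) via an injective map ι : V(D) → V(D') that
    -- is an isomorphism of rooted trees onto the closure.
    IsPartialSolutionNode : (t : Fin (RGraph.size T)) (D : RGraph)
      → (Fin n → Fin (RGraph.size D)) → Subset (RGraph.size D) → Set
    IsPartialSolutionNode t D τ S =
      ∃[ D' ] ∃[ τ' ] ∃[ ι ] (
          IsPartialSolutionFor (InGt T β t) D' τ'
        × (∀ x y → ι x ≡ ι y → x ≡ y)
        × (∀ x → RGraph.par D' (ι x) ≡ Data.Maybe.map ι (RGraph.par D x))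
        × (∀ y → (∃[ x ] ι x ≡ y) ⇔ (∃[ v ] (v ∈ β t × Anc D' y (τ' v))))
        × (∀ v → v ∈ β t → ι (τ v) ≡ τ' v)
        × (∀ x → x ∈ S ⇔ (∃[ u ] (InGt T β t u × u ∉ β t × τ' u ≡ ι x)))
        × (∀ y → ¬ (∃[ x ] ι x ≡ y) → ∃[ u ] (InGt T β t u × u ∉ β t × τ' u ≡ y)))
      where import Data.Maybe

    IsPromising : (t : Fin (RGraph.size T)) (D : RGraph)
      → (Fin n → Fin (RGraph.size D)) → Subset (RGraph.size D) → Set
    IsPromising t D τ S =
        IsPartialSolutionNode t D τ S
      × (∀ x y → Edge D x y → x ∈ S → y ∈ S ⊎ (∃[ v ] (v ∈ β t × τ v ≡ y)))

{-# OPTIONS --safe #-}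
module Submission where

-- Every vertex of D lies above some vertex of τ(β t), and promising means that
-- S is closed under tree edges except those entering τ(β t). So walking down
-- from a vertex x ∉ τ(β t) towards τ(β t), membership in S is constant until the
-- walk first reaches some z ∈ τ(β t); hence x ∈ S iff parent(z) ∈ S. A promising S
-- is therefore determined by 2 ∣β t∣ ≤ 2 (2k + 1) bits, which gives at most
-- 2 ^ (4k + 2) ≤ 2 ^ (6k) of them.

open import Defs
open import Data.Nat using (ℕ; suc; _≤_; _*_; _^_; _+_)
open import Data.Nat.Properties using (+-mono-≤; +-monoˡ-≤; *-monoʳ-≤; ^-monoʳ-≤; ^-distribˡ-+-*; module ≤-Reasoning)
open import Data.Nat.Tactic.RingSolver using (solve-∀)
open import Data.Fin using (Fin; zero; suc; combine; funToFin; finToFun)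
open import Data.Fin.Properties using (injective⇒≤; combine-injective; finToFun-funToFin; 2↔Bool; any?; _≟_)
open import Data.Fin.Subset using (Subset; _∈_; ∣_∣)
open import Data.Fin.Subset.Properties using (⊆-antisym)
open import Data.Product using (∃-syntax; _,_; _×_; proj₁; proj₂)
open import Data.Sum using (_⊎_; inj₁; inj₂; [_,_]′)
open import Data.Bool using (Bool; true; false)
open import Data.Maybe using (just; maybe′)
import Data.Maybe as Maybe
open import Data.Vec using (_∷_; lookup; here; there)
open import Data.Vec.Properties using ([]=⇒lookup; lookup⇒[]=)
open import Data.List using (List; length)
import Data.List as List
open import Data.List.Membership.Propositional.Properties using (∈-lookup)
open import Data.List.Relation.Unary.All using (All)
import Data.List.Relation.Unary.All as All
open import Data.List.Relation.Unary.AllPairs using (_∷_)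
open import Data.List.Relation.Unary.Unique.Propositional using (Unique)
open import Data.Empty using (⊥-elim)
open import Relation.Nullary using (¬_; Dec; yes; no)
open import Relation.Binary.PropositionalEquality using (_≡_; refl; sym; trans; cong; subst; module ≡-Reasoning)
open import Function using (_∘_; id; _⇔_; mk⇔; Equivalence; Inverse)
import Function.Properties.Equivalence as ⇔

lookup-injective : ∀ {A : Set} {xs : List A} → Unique xs
  → ∀ i j → List.lookup xs i ≡ List.lookup xs j → i ≡ j
lookup-injective (_ ∷ _) zero zero _ = refl
lookup-injective (x∉xs ∷ _) zero (suc j) eq = ⊥-elim (All.lookup x∉xs (∈-lookup j) eq)
lookup-injective (x∉xs ∷ _) (suc i) zero eq = ⊥-elim (All.lookup x∉xs (∈-lookup i) (sym eq))
lookup-injective (_ ∷ u) (suc i) (suc j) eq = cong suc (lookup-injective u i j eq)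

length≤-of-injectiveOn : ∀ {A : Set} {P : A → Set} {N} (h : A → Fin N)
  → (∀ {a b} → P a → P b → h a ≡ h b → a ≡ b)
  → {xs : List A} → Unique xs → All P xs → length xs ≤ N
length≤-of-injectiveOn h h-inj {xs} u ps = injective⇒≤ {f = h ∘ List.lookup xs}
  (λ {i} {j} eq → lookup-injective u i j
    (h-inj (All.lookup ps (∈-lookup i)) (All.lookup ps (∈-lookup j)) eq))

code : ∀ {m} → (Fin m → Bool) → Fin (2 ^ m)
code f = funToFin (Inverse.from 2↔Bool ∘ f)

code-injective : ∀ {m} {f g : Fin m → Bool} → code f ≡ code g → ∀ i → f i ≡ g i
code-injective {f = f} {g} eq i = begin
  f i                       ≡⟨ sym (strictlyInverseˡ (f i)) ⟩
  to (from (f i))           ≡⟨ cong to (finToFun-funToFin (from ∘ f) i) ⟨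
  to (finToFun (code f) i)  ≡⟨ cong (λ c → to (finToFun c i)) eq ⟩
  to (finToFun (code g) i)  ≡⟨ cong to (finToFun-funToFin (from ∘ g) i) ⟩
  to (from (g i))           ≡⟨ strictlyInverseˡ (g i) ⟩
  g i                       ∎
  where
  open ≡-Reasoning
  open Inverse 2↔Bool using (to; from; strictlyInverseˡ)

elements : ∀ {n} (p : Subset n) → Fin ∣ p ∣ → Fin n
elements (true ∷ p) zero = zero
elements (true ∷ p) (suc i) = suc (elements p i)
elements (false ∷ p) i = suc (elements p i)

elements-surjective : ∀ {n} (p : Subset n) {x} → x ∈ p → ∃[ j ] elements p j ≡ x
elements-surjective (true ∷ p) here = zero , refl
elements-surjective (true ∷ p) (there x∈p) with j , refl ← elements-surjective p x∈p = suc j , refl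
elements-surjective (false ∷ p) (there x∈p) with j , refl ← elements-surjective p x∈p = j , refl

lookup-≡⇒∈⇔ : ∀ {n} {p q : Subset n} {x} → lookup p x ≡ lookup q x → x ∈ p ⇔ x ∈ q
lookup-≡⇒∈⇔ {p = p} {q} {x} eq = mk⇔
  (λ x∈p → lookup⇒[]= x q (trans (sym eq) ([]=⇒lookup x∈p)))
  (λ x∈q → lookup⇒[]= x p (trans eq ([]=⇒lookup x∈q)))

Edge-sym : ∀ (D : RGraph) {x y} → Edge D x y → Edge D y x
Edge-sym D (inj₁ e) = inj₂ e
Edge-sym D (inj₂ e) = inj₁ e

module _ {D D' : RGraph} (ι : Fin (RGraph.size D) → Fin (RGraph.size D'))
         (ι-injective : ∀ x y → ι x ≡ ι y → x ≡ y)
         (ι-par : ∀ x → RGraph.par D' (ι x) ≡ Maybe.map ι (RGraph.par D x)) where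

  Anc-reflect : ∀ {x y} → Anc D' (ι x) (ι y) → Anc D x y
  Anc-reflect a = go a refl
    where
    go : ∀ {x y y'} → Anc D' (ι x) y' → y' ≡ ι y → Anc D x y
    go {x} anc-refl eq = subst (Anc D x) (ι-injective x _ eq) anc-refl
    go {y = y} (anc-step par-ιy≡p' a) refl with RGraph.par D y in par-y | trans (sym par-ιy≡p') (ι-par y)
    ... | just p | refl = anc-step par-y (go a refl)

module Boundary (D : RGraph) {m : ℕ} (b : Fin m → Fin (RGraph.size D)) where
  open RGraph D

  OnBoundary : Fin size → Set
  OnBoundary x = ∃[ j ] b j ≡ x

  onBoundary? : ∀ x → Dec (OnBoundary x)
  onBoundary? x = any? (λ j → b j ≟ x)

  IsClosureOfBoundary : Set
  IsClosureOfBoundary = ∀ x → ∃[ j ] Anc D x (b j)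

  Closed : Subset size → Set
  Closed S = ∀ x y → Edge D x y → x ∈ S → y ∈ S ⊎ OnBoundary y

  SameSide : Fin size → Fin size → Set
  SameSide x y = ∀ S → Closed S → x ∈ S ⇔ y ∈ S

  sameSide-edge : ∀ {x y} → Edge D x y → ¬ OnBoundary x → ¬ OnBoundary y → SameSide x y
  sameSide-edge e x∉∂ y∉∂ S closed = mk⇔ (cross e y∉∂) (cross (Edge-sym D e) x∉∂)
    where
    cross : ∀ {u v} → Edge D u v → ¬ OnBoundary v → u ∈ S → v ∈ S
    cross e v∉∂ u∈S = [ id , ⊥-elim ∘ v∉∂ ]′ (closed _ _ e u∈S)

  sameSide-trans : ∀ {x y z} → SameSide x y → SameSide y z → SameSide x z
  sameSide-trans x~y y~z S closed = ⇔.trans (x~y S closed) (y~z S closed)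

  descend : ∀ {x y} → Anc D x y → ¬ OnBoundary x
    → (SameSide x y × ¬ OnBoundary y) ⊎ ∃[ j ] ∃[ p ] (par (b j) ≡ just p × SameSide x p)
  descend anc-refl x∉∂ = inj₁ ((λ _ _ → ⇔.refl) , x∉∂)
  descend {y = y} (anc-step par-y≡p a) x∉∂ with descend a x∉∂
  ... | inj₂ found = inj₂ found
  ... | inj₁ (x~p , p∉∂) with onBoundary? y
  ...   | yes (j , refl) = inj₂ (j , _ , par-y≡p , x~p)
  ...   | no y∉∂ = inj₁ (sameSide-trans x~p (sameSide-edge (inj₂ par-y≡p) p∉∂ y∉∂) , y∉∂)

  sameSide-boundaryParent : IsClosureOfBoundary → ∀ {x} → ¬ OnBoundary x
    → ∃[ j ] ∃[ p ] (par (b j) ≡ just p × SameSide x p)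
  sameSide-boundaryParent closure {x} x∉∂ with j , x≼bj ← closure x with descend x≼bj x∉∂
  ... | inj₁ (_ , bj∉∂) = ⊥-elim (bj∉∂ (j , refl))
  ... | inj₂ found = found

  parentIn : Subset size → Fin size → Bool
  parentIn S x = maybe′ (lookup S) false (par x)

  signature : Subset size → Fin (2 ^ m * 2 ^ m)
  signature S = combine (code (lookup S ∘ b)) (code (parentIn S ∘ b))

  signature-injective : IsClosureOfBoundary → ∀ {S₁ S₂} → Closed S₁ → Closed S₂
    → signature S₁ ≡ signature S₂ → S₁ ≡ S₂
  signature-injective closure {S₁} {S₂} closed₁ closed₂ eq =
    ⊆-antisym (Equivalence.to (agree _)) (Equivalence.from (agree _))
    where
    codes-agree : code (lookup S₁ ∘ b) ≡ code (lookup S₂ ∘ b) × code (parentIn S₁ ∘ b) ≡ code (parentIn S₂ ∘ b)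
    codes-agree = combine-injective _ _ _ _ eq

    agree-on-boundary : ∀ j → lookup S₁ (b j) ≡ lookup S₂ (b j)
    agree-on-boundary = code-injective (proj₁ codes-agree)

    agree-on-parent : ∀ {j p} → par (b j) ≡ just p → lookup S₁ p ≡ lookup S₂ p
    agree-on-parent {j} {p} par-bj≡p = begin
      lookup S₁ p       ≡⟨ cong (maybe′ (lookup S₁) false) par-bj≡p ⟨
      parentIn S₁ (b j) ≡⟨ code-injective (proj₂ codes-agree) j ⟩
      parentIn S₂ (b j) ≡⟨ cong (maybe′ (lookup S₂) false) par-bj≡p ⟩
      lookup S₂ p       ∎
      where open ≡-Reasoning

    agree : ∀ x → x ∈ S₁ ⇔ x ∈ S₂
    agree x with onBoundary? x
    ... | yes (j , refl) = lookup-≡⇒∈⇔ (agree-on-boundary j)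
    ... | no x∉∂ with j , p , par-bj≡p , x~p ← sameSide-boundaryParent closure x∉∂ =
      ⇔.trans (x~p S₁ closed₁)
        (⇔.trans (lookup-≡⇒∈⇔ (agree-on-parent par-bj≡p)) (⇔.sym (x~p S₂ closed₂)))

module BagBoundary (G : Graph) (k : ℕ) (TD : NiceTD G) (t : Fin (RGraph.size (NiceTD.T TD)))
                   (D : RGraph) (τ : Fin (Graph.n G) → Fin (RGraph.size D)) where
  open NiceTD TD using (β)

  open Boundary D (τ ∘ elements (β t)) public

  partialSolution-isClosureOfBoundary : ∀ {S} → IsPartialSolutionNode G k TD t D τ S → IsClosureOfBoundary
  partialSolution-isClosureOfBoundary (_ , _ , ι , _ , ι-injective , ι-par , ι-image , ι-τ , _) x
    with v , v∈β , ιx≼τ'v ← Equivalence.to (ι-image (ι x)) (x , refl)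
    with j , refl ← elements-surjective (β t) v∈β
    = j , Anc-reflect ι ι-injective ι-par (subst (Anc _ (ι x)) (sym (ι-τ _ v∈β)) ιx≼τ'v)

  promising-closed : ∀ {S} → IsPromising G k TD t D τ S → Closed S
  promising-closed (_ , closed) x y e x∈S with closed x y e x∈S
  ... | inj₁ y∈S = inj₁ y∈S
  ... | inj₂ (v , v∈β , refl) with j , refl ← elements-surjective (β t) v∈β = inj₂ (j , refl)

  signature-injectiveOn-promising : ∀ {S₁ S₂} → IsPromising G k TD t D τ S₁ → IsPromising G k TD t D τ S₂
    → signature S₁ ≡ signature S₂ → S₁ ≡ S₂
  signature-injectiveOn-promising pr₁ pr₂ =
    signature-injective (partialSolution-isClosureOfBoundary (proj₁ pr₁))
      (promising-closed pr₁) (promising-closed pr₂)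

double-bag≤6k : ∀ {k m} → 1 ≤ k → m ≤ suc (2 * k) → m + m ≤ 6 * k
double-bag≤6k {k} {m} 1≤k m≤1+2k = begin
  m + m                         ≤⟨ +-mono-≤ m≤1+2k m≤1+2k ⟩
  suc (2 * k) + suc (2 * k)     ≡⟨ regroup k ⟩
  2 * 1 + 4 * k                 ≤⟨ +-monoˡ-≤ (4 * k) (*-monoʳ-≤ 2 1≤k) ⟩
  2 * k + 4 * k                 ≡⟨ collect k ⟩
  6 * k                         ∎
  where
  open ≤-Reasoning
  regroup : ∀ k → suc (2 * k) + suc (2 * k) ≡ 2 * 1 + 4 * k
  regroup = solve-∀
  collect : ∀ k → 2 * k + 4 * k ≡ 6 * k
  collect = solve-∀

lemma22 : ∃[ c ] ((G : Graph) (k : ℕ) → 1 ≤ k → (TD : NiceTD G) → WidthAtMost TD (2 * k)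
            → (t : Fin (RGraph.size (NiceTD.T TD))) (D : RGraph) (τ : Fin (Graph.n G) → Fin (RGraph.size D))
            → (Ss : List (Subset (RGraph.size D))) → Unique Ss
            → All (IsPromising G k TD t D τ) Ss
            → length Ss ≤ 2 ^ (c * k))
lemma22 = 6 , λ G k 1≤k TD width t D τ Ss unique promising →
  let open BagBoundary G k TD t D τ
      m = ∣ NiceTD.β TD t ∣
  in begin
    length Ss       ≤⟨ length≤-of-injectiveOn signature signature-injectiveOn-promising unique promising ⟩
    2 ^ m * 2 ^ m   ≡⟨ ^-distribˡ-+-* 2 m m ⟨
    2 ^ (m + m)     ≤⟨ ^-monoʳ-≤ 2 (double-bag≤6k 1≤k (width t)) ⟩
    2 ^ (6 * k)     ∎
  where open ≤-Reasoning
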